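{- Let $n\ge 6$ and let $v$ be a vertex of the Kneser graph $K(n,2)$. Then $\Pi_v^v(K(n,2))$ is generated by the classes of the $3$-cycles based at $v$, i.e. closed walks of the form $(v\,w_2\,w_3\,v)$.
   Context: The Kneser graph $K(n,2)$ is the loopless graph whose vertices are the $2$-element subsets of $\{1,\dots,n\}$, two vertices adjacent iff the subsets are disjoint. A walk is a sequence $(v_0\cdots v_m)$ with $v_i\sim v_{i+1}$. A prune of a walk with $v_i=v_{i+2}$ replaces the segment $v_iv_{i+1}v_i$ by $v_i$; a spider move on $(v_0\cdots v_m)$ replaces one vertex $v_i$, $0<i<m$, by a vertex $v_i'$ with $v_{i-1}\sim v_i'\sim v_{i+1}$. Two walks are equivalent if connected by finitely many prunes, inverse prunes and spider moves. $\Pi_v^v(G)$ is the group of equivalence classes of closed walks starting and ending at $v$, under concatenation. -}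

module Defs where

open import Data.Nat using (ℕ; zero; suc; _<ᵇ_; _≡ᵇ_)
open import Data.Fin using (Fin; toℕ)
open import Data.Bool using (Bool; true; false; not; _∧_; T)
open import Data.List using (List; []; _∷_)
open import Data.Product using (_×_; _,_)
open import Relation.Binary.PropositionalEquality using (_≡_; refl)
open import Relation.Binary.Construct.Closure.Equivalence using (EqClosure)

-- Vertices of the Kneser graph K(n,2): 2-element subsets {a,b} of an n-set,
-- represented canonically as a pair a < b of elements of Fin n.
record Vtx (n : ℕ) : Set where
  constructor ⟨_,_,_⟩
  field
    a : Fin n
    b : Fin n
    ord : T (toℕ a <ᵇ toℕ b)

_≠ᵇ_ : {n : ℕ} → Fin n → Fin n → Bool
x ≠ᵇ y = not (toℕ x ≡ᵇ toℕ y)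

disjᵇ : {n : ℕ} → Vtx n → Vtx n → Bool
disjᵇ ⟨ a , b , _ ⟩ ⟨ c , d , _ ⟩ = (a ≠ᵇ c) ∧ (a ≠ᵇ d) ∧ (b ≠ᵇ c) ∧ (b ≠ᵇ d)

_~_ : {n : ℕ} → Vtx n → Vtx n → Set
u ~ w = T (disjᵇ u w)

≡ᵇ-comm : (m k : ℕ) → (m ≡ᵇ k) ≡ (k ≡ᵇ m)
≡ᵇ-comm zero zero = refl
≡ᵇ-comm zero (suc k) = refl
≡ᵇ-comm (suc m) zero = refl
≡ᵇ-comm (suc m) (suc k) = ≡ᵇ-comm m k

∧-swap : (x y z w : Bool) → T (x ∧ y ∧ z ∧ w) → T (x ∧ z ∧ y ∧ w)
∧-swap true true true true t = t
∧-swap true true false w ()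
∧-swap true false z w ()
∧-swap false y z w ()

~-sym : {n : ℕ} {u w : Vtx n} → u ~ w → w ~ u
~-sym {u = ⟨ a , b , _ ⟩} {⟨ c , d , _ ⟩} p
  rewrite ≡ᵇ-comm (toℕ c) (toℕ a) | ≡ᵇ-comm (toℕ c) (toℕ b)
        | ≡ᵇ-comm (toℕ d) (toℕ a) | ≡ᵇ-comm (toℕ d) (toℕ b)
  = ∧-swap (a ≠ᵇ c) (a ≠ᵇ d) (b ≠ᵇ c) (b ≠ᵇ d) p

data Walk {n : ℕ} : Vtx n → Vtx n → Set where
  [_] : (u : Vtx n) → Walk u u
  _∷⟨_⟩_ : (u : Vtx n) {x w : Vtx n} → u ~ x → Walk x w → Walk u w

infixr 5 _∷⟨_⟩_ _++ᵂ_

_++ᵂ_ : {n : ℕ} {u x w : Vtx n} → Walk u x → Walk x w → Walk u w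
[ u ] ++ᵂ q = q
(u ∷⟨ p ⟩ r) ++ᵂ q = u ∷⟨ p ⟩ (r ++ᵂ q)

data Move {n : ℕ} : {u w : Vtx n} → Walk u w → Walk u w → Set where
  prune  : {u x w : Vtx n} (p : u ~ x) (q : x ~ u) (r : Walk u w) →
           Move (u ∷⟨ p ⟩ x ∷⟨ q ⟩ r) r
  spider : {u x x' y w : Vtx n} (p : u ~ x) (q : x ~ y) (p' : u ~ x') (q' : x' ~ y)
           (r : Walk y w) →
           Move (u ∷⟨ p ⟩ x ∷⟨ q ⟩ r) (u ∷⟨ p' ⟩ x' ∷⟨ q' ⟩ r)
  there  : {u x w : Vtx n} (p : u ~ x) {r r' : Walk x w} →
           Move r r' → Move (u ∷⟨ p ⟩ r) (u ∷⟨ p ⟩ r')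

_≈ᵂ_ : {n : ℕ} {u w : Vtx n} → Walk u w → Walk u w → Set
_≈ᵂ_ = EqClosure Move

record ThreeCycle {n : ℕ} (v : Vtx n) : Set where
  constructor tri
  field
    w₂ w₃ : Vtx n
    e₁ : v ~ w₂
    e₂ : w₂ ~ w₃
    e₃ : w₃ ~ v

cycleWalk : {n : ℕ} {v : Vtx n} → ThreeCycle v → Walk v v
cycleWalk {v = v} (tri w₂ w₃ e₁ e₂ e₃) = v ∷⟨ e₁ ⟩ w₂ ∷⟨ e₂ ⟩ w₃ ∷⟨ e₃ ⟩ [ v ]

-- the reversed walk (v w3 w2 v), representing the inverse class in Π_v^v
cycleWalkInv : {n : ℕ} {v : Vtx n} → ThreeCycle v → Walk v v
cycleWalkInv {v = v} (tri w₂ w₃ e₁ e₂ e₃) =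
  v ∷⟨ ~-sym {u = w₃} {w = v} e₃ ⟩ w₃ ∷⟨ ~-sym {u = w₂} {w = w₃} e₂ ⟩ w₂ ∷⟨ ~-sym {u = v} {w = w₂} e₁ ⟩ [ v ]

-- a word in the generators and their inverses: (c , true) = c, (c , false) = c⁻¹
letter : {n : ℕ} {v : Vtx n} → ThreeCycle v × Bool → Walk v v
letter (c , true)  = cycleWalk c
letter (c , false) = cycleWalkInv c

evalWord : {n : ℕ} {v : Vtx n} → List (ThreeCycle v × Bool) → Walk v v
evalWord {v = v} [] = [ v ]
evalWord (g ∷ gs) = letter g ++ᵂ evalWord gs

-- A closed walk v x y z ⋯ v can be shortened at the cost of a triangle at v.
-- Choose x' disjoint from v ∪ y containing the points of z outside v (these
-- miss y since y ~ z), then w disjoint from v ∪ x' ⊇ z; both exist since n ≥ 6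
-- leaves two points outside any four. The spider moves x ↦ x' and y ↦ w followed by an inverse
-- prune at w turn the walk into (v x' w v) followed by v w z ⋯ v, which is one
-- step shorter; walks of length at most two reduce to v by a prune.
module Submission where

open import Defs
open import Data.Nat using (ℕ; _+_; _≤_; _<_)
open import Data.Nat.Properties using (≡ᵇ⇒≡; ≡⇒≡ᵇ; <⇒<ᵇ; <-cmp; <⇒≱; <-trans; n<1+n)
open import Data.Fin using (Fin; toℕ; _≟_)
open import Data.Fin.Properties using (toℕ-injective; ¬∀⟶∃¬; injective⇒≤)
open import Data.Bool using (Bool; true; T; _∧_)
open import Data.Bool.Properties using (T-≡; T-not-≡; ¬-not)
open import Data.Empty using (⊥-elim)
open import Data.Sum using ([_,_]′)
open import Data.Product using (Σ-syntax; ∃; _×_; _,_; proj₁; proj₂)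
import Data.Product as Product
open import Data.List using (List; []; _∷_; _++_; length; lookup)
open import Data.List.Relation.Unary.Any using (here; there; index; any?)
open import Data.List.Relation.Unary.Any.Properties using (lookup-index)
open import Data.List.Membership.Propositional using (_∈_; _∉_)
open import Data.List.Membership.Propositional.Properties using (∈-++⁺ˡ; ∈-++⁺ʳ; ∈-++⁻)
open import Data.List.Relation.Binary.Subset.Propositional using (_⊆_)
open import Data.List.Relation.Binary.Disjoint.Propositional using (Disjoint)
open import Function using (_∘_; Equivalence)
open import Relation.Nullary using (¬_; yes; no)
open import Relation.Binary.PropositionalEquality using (_≢_; refl; sym; trans; cong; subst)
open import Relation.Binary.Definitions using (tri<; tri≈; tri>)
open import Relation.Binary.Construct.Closure.ReflexiveTransitive using (ε; _◅_; _◅◅_)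
open import Relation.Binary.Construct.Closure.Symmetric using (fwd; bwd)
import Relation.Binary.Construct.Closure.Equivalence as EqClosure

private
  variable
    n : ℕ
    A : Set

fresh : (L : List (Fin n)) → length L < n → ∃ λ e → e ∉ L
fresh {n} L |L|<n = ¬∀⟶∃¬ n (_∈ L) (λ e → any? (e ≟_) L) λ all∈ →
  <⇒≱ |L|<n (injective⇒≤ {f = index ∘ all∈} λ {i} {j} eq →
    trans (lookup-index (all∈ i)) (trans (cong (lookup L) eq) (sym (lookup-index (all∈ j)))))

∉-pair : {x y : A} {L : List A} → x ∉ L → y ∉ L → Disjoint (x ∷ y ∷ []) L
∉-pair x∉L y∉L (here refl , t∈L) = x∉L t∈L
∉-pair x∉L y∉L (there (here refl) , t∈L) = y∉L t∈L

∈-pair : {x y : A} {L : List A} → x ∈ L → y ∈ L → (x ∷ y ∷ []) ⊆ L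
∈-pair x∈L y∈L (here refl) = x∈L
∈-pair x∈L y∈L (there (here refl)) = y∈L

∉-++⁺ : {x : A} {xs ys : List A} → x ∉ xs → x ∉ ys → x ∉ xs ++ ys
∉-++⁺ {xs = xs} x∉xs x∉ys = [ x∉xs , x∉ys ]′ ∘ ∈-++⁻ xs

Disjoint-++⁻ : {us xs ys : List A} → Disjoint us (xs ++ ys) → Disjoint us xs × Disjoint us ys
Disjoint-++⁻ {xs = xs} d = (λ (t∈u , t∈x) → d (t∈u , ∈-++⁺ˡ t∈x))
                         , (λ (t∈u , t∈y) → d (t∈u , ∈-++⁺ʳ xs t∈y))

elems : Vtx n → List (Fin n)
elems ⟨ a , b , _ ⟩ = a ∷ b ∷ []

≠ᵇ⇒≢ : {x y : Fin n} → T (x ≠ᵇ y) → x ≢ y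
≠ᵇ⇒≢ {x = x} x≠x refl = subst T (Equivalence.to T-not-≡ x≠x) (≡⇒≡ᵇ (toℕ x) (toℕ x) refl)

≢⇒≠ᵇ : {x y : Fin n} → x ≢ y → T (x ≠ᵇ y)
≢⇒≠ᵇ {x = x} {y} x≢y = Equivalence.from T-not-≡ (¬-not λ x≡ᵇy →
  x≢y (toℕ-injective (≡ᵇ⇒≡ (toℕ x) (toℕ y) (Equivalence.from T-≡ x≡ᵇy))))

T-∧₄⁻ : {p q r s : Bool} → T (p ∧ q ∧ r ∧ s) → T p × T q × T r × T s
T-∧₄⁻ {true} {true} {true} {true} _ = _ , _ , _ , _

T-∧₄⁺ : {p q r s : Bool} → T p → T q → T r → T s → T (p ∧ q ∧ r ∧ s)
T-∧₄⁺ {true} {true} {true} {true} _ _ _ _ = _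

~⇒Disjoint : {u w : Vtx n} → u ~ w → Disjoint (elems u) (elems w)
~⇒Disjoint {u = ⟨ a , b , _ ⟩} {⟨ c , d , _ ⟩} u~w = apart (T-∧₄⁻ u~w)
  where
  apart : T (a ≠ᵇ c) × T (a ≠ᵇ d) × T (b ≠ᵇ c) × T (b ≠ᵇ d) → Disjoint (a ∷ b ∷ []) (c ∷ d ∷ [])
  apart (a≠c , _ , _ , _) (here refl , here t≡c) = ≠ᵇ⇒≢ a≠c t≡c
  apart (_ , a≠d , _ , _) (here refl , there (here t≡d)) = ≠ᵇ⇒≢ a≠d t≡d
  apart (_ , _ , b≠c , _) (there (here refl) , here t≡c) = ≠ᵇ⇒≢ b≠c t≡c
  apart (_ , _ , _ , b≠d) (there (here refl) , there (here t≡d)) = ≠ᵇ⇒≢ b≠d t≡d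

Disjoint⇒~ : {u w : Vtx n} → Disjoint (elems u) (elems w) → u ~ w
Disjoint⇒~ {u = ⟨ a , b , _ ⟩} {⟨ c , d , _ ⟩} u#w =
  T-∧₄⁺ (≢⇒≠ᵇ λ a≡c → u#w (here refl , here a≡c))
        (≢⇒≠ᵇ λ a≡d → u#w (here refl , there (here a≡d)))
        (≢⇒≠ᵇ λ b≡c → u#w (there (here refl) , here b≡c))
        (≢⇒≠ᵇ λ b≡d → u#w (there (here refl) , there (here b≡d)))

Disjoint-++⇒~ : {u v w : Vtx n} → Disjoint (elems u) (elems v ++ elems w) → u ~ v × u ~ w
Disjoint-++⇒~ {u = u} {v} {w} u#vw =
  Product.map (Disjoint⇒~ {u = u} {v}) (Disjoint⇒~ {u = u} {w}) (Disjoint-++⁻ {xs = elems v} u#vw)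

vertex-through : (t : Fin n) (L : List (Fin n)) → t ∉ L → 1 + length L < n →
                 Σ[ u ∈ Vtx n ] t ∈ elems u × Disjoint (elems u) L
vertex-through t L t∉L |t∷L|<n with fresh (t ∷ L) |t∷L|<n
... | e , e∉t∷L with <-cmp (toℕ t) (toℕ e)
...   | tri< t<e _ _ = ⟨ t , e , <⇒<ᵇ t<e ⟩ , here refl , ∉-pair t∉L (e∉t∷L ∘ there)
...   | tri≈ _ t≡e _ = ⊥-elim (e∉t∷L (here (toℕ-injective (sym t≡e))))
...   | tri> _ _ e<t = ⟨ e , t , <⇒<ᵇ e<t ⟩ , there (here refl) , ∉-pair (e∉t∷L ∘ there) t∉L

vertex-avoiding : (L : List (Fin n)) → 1 + length L < n → Σ[ u ∈ Vtx n ] Disjoint (elems u) L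
vertex-avoiding L |L|+1<n with fresh L (<-trans (n<1+n (length L)) |L|+1<n)
... | t , t∉L = Product.map₂ proj₂ (vertex-through t L t∉L |L|+1<n)

record Pivot (v y z : Vtx n) : Set where
  constructor pivot
  field
    x'     : Vtx n
    x'~v   : x' ~ v
    x'~y   : x' ~ y
    z⊆v∪x' : elems z ⊆ elems v ++ elems x'

pivot-self : {v y z : Vtx n} → y ~ z → z ~ v → Pivot v y z
pivot-self {v = v} {y} {z} y~z z~v = pivot z z~v (~-sym {u = y} {w = z} y~z) (∈-++⁺ʳ (elems v))

pivot-through : 6 ≤ n → {v y z : Vtx n} {t : Fin n} → y ~ z → t ∈ elems z → t ∉ elems v →
                elems z ⊆ t ∷ elems v → Pivot v y z
pivot-through 6≤n {v} {y} {z} {t} y~z t∈z t∉v z⊆t∷v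
  with vertex-through t (elems v ++ elems y) (∉-++⁺ t∉v λ t∈y → ~⇒Disjoint {u = y} {z} y~z (t∈y , t∈z)) 6≤n
... | x' , t∈x' , x'#v∪y = pivot x' (proj₁ x'~v∪y) (proj₂ x'~v∪y) z⊆v∪x'
  where
  x'~v∪y = Disjoint-++⇒~ {u = x'} {v} {y} x'#v∪y
  z⊆v∪x' : elems z ⊆ elems v ++ elems x'
  z⊆v∪x' s∈z with z⊆t∷v s∈z
  ... | here refl = ∈-++⁺ʳ (elems v) t∈x'
  ... | there s∈v = ∈-++⁺ˡ s∈v

pivot-inside : 6 ≤ n → {v y z : Vtx n} → elems z ⊆ elems v → Pivot v y z
pivot-inside 6≤n {v} {y} {z} z⊆v with vertex-avoiding (elems v ++ elems y) 6≤n
... | x' , x'#v∪y = pivot x' (proj₁ x'~v∪y) (proj₂ x'~v∪y) (∈-++⁺ˡ ∘ z⊆v)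
  where x'~v∪y = Disjoint-++⇒~ {u = x'} {v} {y} x'#v∪y

find-pivot : 6 ≤ n → (v : Vtx n) {y z : Vtx n} → y ~ z → Pivot v y z
find-pivot 6≤n v {z = z@(⟨ c , d , _ ⟩)} y~z with any? (c ≟_) (elems v) | any? (d ≟_) (elems v)
... | no c∉v  | no d∉v  = pivot-self y~z (Disjoint⇒~ {u = z} {v} (∉-pair c∉v d∉v))
... | yes c∈v | no d∉v  = pivot-through 6≤n y~z (there (here refl)) d∉v (∈-pair (there c∈v) (here refl))
... | no c∉v  | yes d∈v = pivot-through 6≤n y~z (here refl) c∉v (∈-pair (here refl) (there d∈v))
... | yes c∈v | yes d∈v = pivot-inside 6≤n (∈-pair c∈v d∈v)

record Shortcut (v y z : Vtx n) : Set where
  constructor shortcut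
  field
    x' w : Vtx n
    v~x' : v ~ x'
    x'~y : x' ~ y
    x'~w : x' ~ w
    w~z  : w ~ z
    w~v  : w ~ v

  triangle : ThreeCycle v
  triangle = tri x' w v~x' x'~w w~v

find-shortcut : 6 ≤ n → (v : Vtx n) {y z : Vtx n} → y ~ z → Shortcut v y z
find-shortcut 6≤n v {y} {z} y~z with find-pivot 6≤n v {y} {z} y~z
... | pivot x' x'~v x'~y z⊆v∪x' with vertex-avoiding (elems v ++ elems x') 6≤n
...   | w , w#v∪x' =
  shortcut x' w (~-sym {u = x'} {w = v} x'~v) x'~y (~-sym {u = w} {w = x'} (proj₂ w~v∪x'))
           (Disjoint⇒~ {u = w} {z} λ (t∈w , t∈z) → w#v∪x' (t∈w , z⊆v∪x' t∈z)) (proj₁ w~v∪x')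
  where w~v∪x' = Disjoint-++⇒~ {u = w} {v} {x'} w#v∪x'

~-irrefl : {u : Vtx n} → ¬ (u ~ u)
~-irrefl {u = u} u~u = ~⇒Disjoint {u = u} {u} u~u (here refl , here refl)

Move-++⁺ˡ : {u x w : Vtx n} (p : Walk u x) {r r' : Walk x w} → Move r r' → Move (p ++ᵂ r) (p ++ᵂ r')
Move-++⁺ˡ [ _ ] m = m
Move-++⁺ˡ (_ ∷⟨ e ⟩ p) m = there e (Move-++⁺ˡ p m)

≈ᵂ-++⁺ˡ : {u x w : Vtx n} (p : Walk u x) {r r' : Walk x w} → r ≈ᵂ r' → (p ++ᵂ r) ≈ᵂ (p ++ᵂ r')
≈ᵂ-++⁺ˡ p = EqClosure.gmap (p ++ᵂ_) (Move-++⁺ˡ p)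

reroute : {v x y z : Vtx n} (S : Shortcut v y z) (p : v ~ x) (q : x ~ y) (s : y ~ z) (r : Walk z v) →
          let open Shortcut S in
          (v ∷⟨ p ⟩ x ∷⟨ q ⟩ y ∷⟨ s ⟩ r)
            ≈ᵂ (cycleWalk triangle ++ᵂ v ∷⟨ ~-sym {u = w} {w = v} w~v ⟩ w ∷⟨ w~z ⟩ r)
reroute {v = v} {y = y} (shortcut x' w v~x' x'~y x'~w w~z w~v) p q s r =
  fwd (spider p q v~x' x'~y (y ∷⟨ s ⟩ r)) ◅
  fwd (there v~x' (spider x'~y s x'~w w~z r)) ◅
  bwd (there v~x' (there x'~w (prune w~v (~-sym {u = w} {w = v} w~v) (w ∷⟨ w~z ⟩ r)))) ◅ ε

≈ᵂ-triangle-word : {v : Vtx n} → (∀ {y z} → y ~ z → Shortcut v y z) →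
                   {x y : Vtx n} (p : v ~ x) (q : x ~ y) (r : Walk y v) →
                   ∃ λ (gs : List (ThreeCycle v × Bool)) → (v ∷⟨ p ⟩ x ∷⟨ q ⟩ r) ≈ᵂ evalWord gs
≈ᵂ-triangle-word shortcuts p q [ v ] = [] , fwd (prune p q [ v ]) ◅ ε
≈ᵂ-triangle-word {v = v} shortcuts p q (y ∷⟨ s ⟩ r) =
  Product.map ((triangle , true) ∷_) (λ r'≈gs → reroute S p q s r ◅◅ ≈ᵂ-++⁺ˡ (cycleWalk triangle) r'≈gs)
              (≈ᵂ-triangle-word shortcuts (~-sym {u = w} {w = v} w~v) w~z r)
  where
  S = shortcuts s
  open Shortcut S

corollary4p22 : (n : ℕ) → 6 ≤ n → (v : Vtx n) → (c : Walk v v) →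
    ∃ λ (gs : List (ThreeCycle v × Bool)) → c ≈ᵂ evalWord gs
corollary4p22 n 6≤n v [ _ ] = [] , ε
corollary4p22 n 6≤n v (_ ∷⟨ v~v ⟩ [ _ ]) = ⊥-elim (~-irrefl {u = v} v~v)
corollary4p22 n 6≤n v (_ ∷⟨ p ⟩ _ ∷⟨ q ⟩ r) = ≈ᵂ-triangle-word (find-shortcut 6≤n v) p q r
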